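{- Let $X$ be a finite set and $\mathcal{C}\subseteq 2^X$ a set system. Then $\mathcal{C}$ satisfies condition (W') — for all $A,B,C\in\mathcal{C}$, if $A\cap(B\setminus C)\neq\emptyset$ and $A\cap(C\setminus B)\neq\emptyset$ then $B\cap C\subseteq A$ — if and only if $\mathcal{C}$ is a weak hierarchy, i.e., for all $A,B,C\in\mathcal{C}$ we have $A\cap B\cap C\in\{A\cap B,\ A\cap C,\ B\cap C\}$. -}

module Defs where

open import Data.Nat using (ℕ)
open import Data.Fin.Subset using (Subset; _∩_; _─_; _⊆_; Nonempty)
open import Data.Sum using (_⊎_)
open import Relation.Binary.PropositionalEquality using (_≡_)

-- A set system on X = Fin n is a predicate on subsets of X.
-- Condition (W')
W′ : ∀ {n} → (Subset n → Set) → Set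
W′ 𝒞 = ∀ A B C → 𝒞 A → 𝒞 B → 𝒞 C →
       Nonempty (A ∩ (B ─ C)) → Nonempty (A ∩ (C ─ B)) → (B ∩ C) ⊆ A

WeakHierarchy : ∀ {n} → (Subset n → Set) → Set
WeakHierarchy 𝒞 = ∀ A B C → 𝒞 A → 𝒞 B → 𝒞 C →
  (A ∩ B ∩ C ≡ A ∩ B) ⊎ (A ∩ B ∩ C ≡ A ∩ C) ⊎ (A ∩ B ∩ C ≡ B ∩ C)

{-# OPTIONS --safe #-}
-- Fix A, B, C and put E₁ = A ∩ (B ∖ C), E₂ = A ∩ (C ∖ B).  The equalities
-- A ∩ B ∩ C = A ∩ B, = A ∩ C, = B ∩ C amount to A ∩ B ⊆ C, A ∩ C ⊆ B, B ∩ C ⊆ A,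
-- and the first two of these say that E₁, resp. E₂, is empty.  So (W') reads
-- (E₁ ≠ ∅ → E₂ ≠ ∅ → B ∩ C ⊆ A) and the weak hierarchy condition reads
-- (E₁ = ∅ ∨ E₂ = ∅ ∨ B ∩ C ⊆ A); these agree because emptiness of a subset of a
-- finite set is decidable.
module Submission where

open import Defs
open import Data.Nat using (ℕ)
open import Data.Fin.Subset using (Subset; _∩_; _─_; _⊆_; _∈_; _∉_; Nonempty; Empty; inside)
open import Data.Fin.Subset.Properties
  using (_∈?_; nonempty?; ⊆-antisym; p∩q⊆p; x∈p∩q⁺; x∈p∩q⁻; p─q⊆p; x∈p∧x∉q⇒x∈p─q; ∩-assoc; ∩-comm)
open import Data.Product using (_×_; _,_; proj₂)
open import Data.Sum using (_⊎_; inj₁; inj₂)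
open import Data.Vec using (_∷_; here; there)
open import Function.Bundles using (_⇔_; mk⇔; Equivalence)
open import Relation.Nullary using (yes; no; contradiction)
open import Relation.Binary.PropositionalEquality using (_≡_; sym; subst)

open Equivalence using (to; from)

private
  variable
    n : ℕ

x∈p─q⇒x∉q : (p q : Subset n) → ∀ {x} → x ∈ p ─ q → x ∉ q
x∈p─q⇒x∉q (_ ∷ p) (_ ∷ q) (there x∈p─q) (there x∈q) = x∈p─q⇒x∉q p q x∈p─q x∈q
x∈p─q⇒x∉q (_ ∷ p) (inside ∷ q) () here

p∩q≡p⇔p⊆q : {p q : Subset n} → p ∩ q ≡ p ⇔ p ⊆ q
p∩q≡p⇔p⊆q {p = p} {q} = mk⇔
  (λ p∩q≡p {x} x∈p → proj₂ (x∈p∩q⁻ p q (subst (x ∈_) (sym p∩q≡p) x∈p)))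
  (λ p⊆q → ⊆-antisym (p∩q⊆p p q) (λ x∈p → x∈p∩q⁺ (x∈p , p⊆q x∈p)))

p∩q⊆r⇔Empty[p∩[q─r]] : {p q r : Subset n} → p ∩ q ⊆ r ⇔ Empty (p ∩ (q ─ r))
p∩q⊆r⇔Empty[p∩[q─r]] {p = p} {q} {r} = mk⇔ p∩q⊆r⇒Empty Empty⇒p∩q⊆r
  where
  p∩q⊆r⇒Empty : p ∩ q ⊆ r → Empty (p ∩ (q ─ r))
  p∩q⊆r⇒Empty p∩q⊆r (x , x∈p∩[q─r]) =
    let x∈p , x∈q─r = x∈p∩q⁻ p (q ─ r) x∈p∩[q─r]
    in x∈p─q⇒x∉q q r x∈q─r (p∩q⊆r (x∈p∩q⁺ (x∈p , p─q⊆p q r x∈q─r)))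

  Empty⇒p∩q⊆r : Empty (p ∩ (q ─ r)) → p ∩ q ⊆ r
  Empty⇒p∩q⊆r empty {x} x∈p∩q with x ∈? r
  ... | yes x∈r = x∈r
  ... | no  x∉r =
    let x∈p , x∈q = x∈p∩q⁻ p q x∈p∩q
    in contradiction (x , x∈p∩q⁺ (x∈p , x∈p∧x∉q⇒x∈p─q x∈q x∉r)) empty

p∩q∩r≡p∩q⇔p∩q⊆r : (p q r : Subset n) → p ∩ q ∩ r ≡ p ∩ q ⇔ p ∩ q ⊆ r
p∩q∩r≡p∩q⇔p∩q⊆r p q r rewrite sym (∩-assoc p q r) = p∩q≡p⇔p⊆q

p∩q∩r≡p∩r⇔p∩r⊆q : (p q r : Subset n) → p ∩ q ∩ r ≡ p ∩ r ⇔ p ∩ r ⊆ q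
p∩q∩r≡p∩r⇔p∩r⊆q p q r rewrite ∩-comm q r = p∩q∩r≡p∩q⇔p∩q⊆r p r q

p∩q∩r≡q∩r⇔q∩r⊆p : (p q r : Subset n) → p ∩ q ∩ r ≡ q ∩ r ⇔ q ∩ r ⊆ p
p∩q∩r≡q∩r⇔q∩r⊆p p q r rewrite ∩-comm p (q ∩ r) = p∩q≡p⇔p⊆q

module _ (A B C : Subset n) where

  W′Triple : Set
  W′Triple = Nonempty (A ∩ (B ─ C)) → Nonempty (A ∩ (C ─ B)) → B ∩ C ⊆ A

  WeakHierarchyTriple : Set
  WeakHierarchyTriple = (A ∩ B ∩ C ≡ A ∩ B) ⊎ (A ∩ B ∩ C ≡ A ∩ C) ⊎ (A ∩ B ∩ C ≡ B ∩ C)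

  W′Triple⇒WeakHierarchyTriple : W′Triple → WeakHierarchyTriple
  W′Triple⇒WeakHierarchyTriple w′ with nonempty? (A ∩ (B ─ C)) | nonempty? (A ∩ (C ─ B))
  ... | no  A∩[B─C]=∅ | _ =
    inj₁ (from (p∩q∩r≡p∩q⇔p∩q⊆r A B C) (from p∩q⊆r⇔Empty[p∩[q─r]] A∩[B─C]=∅))
  ... | yes _ | no  A∩[C─B]=∅ =
    inj₂ (inj₁ (from (p∩q∩r≡p∩r⇔p∩r⊆q A B C) (from p∩q⊆r⇔Empty[p∩[q─r]] A∩[C─B]=∅)))
  ... | yes A∩[B─C]≠∅ | yes A∩[C─B]≠∅ =
    inj₂ (inj₂ (from (p∩q∩r≡q∩r⇔q∩r⊆p A B C) (w′ A∩[B─C]≠∅ A∩[C─B]≠∅)))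

  WeakHierarchyTriple⇒W′Triple : WeakHierarchyTriple → W′Triple
  WeakHierarchyTriple⇒W′Triple (inj₁ A∩B∩C≡A∩B) A∩[B─C]≠∅ _ =
    contradiction A∩[B─C]≠∅ (to p∩q⊆r⇔Empty[p∩[q─r]] (to (p∩q∩r≡p∩q⇔p∩q⊆r A B C) A∩B∩C≡A∩B))
  WeakHierarchyTriple⇒W′Triple (inj₂ (inj₁ A∩B∩C≡A∩C)) _ A∩[C─B]≠∅ =
    contradiction A∩[C─B]≠∅ (to p∩q⊆r⇔Empty[p∩[q─r]] (to (p∩q∩r≡p∩r⇔p∩r⊆q A B C) A∩B∩C≡A∩C))
  WeakHierarchyTriple⇒W′Triple (inj₂ (inj₂ A∩B∩C≡B∩C)) _ _ =
    to (p∩q∩r≡q∩r⇔q∩r⊆p A B C) A∩B∩C≡B∩C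

theorem2 : (n : ℕ) (𝒞 : Subset n → Set) → (W′ 𝒞 → WeakHierarchy 𝒞) × (WeakHierarchy 𝒞 → W′ 𝒞)
theorem2 n 𝒞 =
  (λ w′ A B C 𝒞A 𝒞B 𝒞C → W′Triple⇒WeakHierarchyTriple A B C (w′ A B C 𝒞A 𝒞B 𝒞C)) ,
  (λ wh A B C 𝒞A 𝒞B 𝒞C → WeakHierarchyTriple⇒W′Triple A B C (wh A B C 𝒞A 𝒞B 𝒞C))
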